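{- The rubbling number of the Petersen graph $P$ is $\rho(P)=5$.
   Context: A pebble distribution on a graph $G$ is a function $p:V(G)\to\mathbb{Z}_{\ge0}$, its size is $\sum_v p(v)$. If $\{v,u\}\in E(G)$, the pebbling move $(v,v\to u)$ removes two pebbles at $v$ and adds one at $u$. If $v\ne w$ and $\{v,u\},\{w,u\}\in E(G)$, the strict rubbling move $(v,w\to u)$ removes one pebble at each of $v$ and $w$ and adds one at $u$. A rubbling move is either of these. A vertex $x$ is reachable from $p$ if there is a sequence of rubbling moves, with pebble counts never becoming negative, after which $x$ has at least one pebble. The rubbling number $\rho(G)$ is the minimum $m$ such that every vertex of $G$ is reachable from every pebble distribution of size $m$. -}

module Defs where

open import Data.Nat using (ℕ; zero; suc; _+_; _∸_; _≤_; _<_)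
open import Data.Fin using (Fin; toℕ)
open import Data.Fin.Properties using (_≟_)
open import Data.Bool using (Bool; true; false; _∨_; _∧_; T; if_then_else_)
open import Data.Nat using (_≡ᵇ_)
open import Data.List using (List; []; _∷_)
open import Data.Bool.ListAction using (any)
open import Data.Product using (_×_; _,_; ∃-syntax)
open import Data.Vec.Functional using (foldr)
open import Relation.Nullary using (¬_; does)
open import Relation.Binary.PropositionalEquality using (_≡_; _≢_)
open import Relation.Binary.Construct.Closure.ReflexiveTransitive using (Star)

-- A graph on the vertex set Fin n, given by its (symmetric, irreflexive) adjacency relation.
Graph : ℕ → Set₁
Graph n = Fin n → Fin n → Set

Distribution : ℕ → Set
Distribution n = Fin n → ℕ

size : ∀ {n} → Distribution n → ℕ
size p = foldr _+_ 0 p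

at : ∀ {n} → Fin n → ℕ → Fin n → ℕ
at v k x = if does (x ≟ v) then k else 0

data Move {n} (G : Graph n) (p : Distribution n) : Distribution n → Set where
  pebbling : (v u : Fin n) → G v u → 2 ≤ p v →
    Move G p (λ x → (p x ∸ at v 2 x) + at u 1 x)
  strict : (v w u : Fin n) → v ≢ w → G v u → G w u → 1 ≤ p v → 1 ≤ p w →
    Move G p (λ x → ((p x ∸ at v 1 x) ∸ at w 1 x) + at u 1 x)

Reachable : ∀ {n} → Graph n → Distribution n → Fin n → Set
Reachable G p x = ∃[ q ] (Star (Move G) p q × 1 ≤ q x)

AllReachable : ∀ {n} → Graph n → ℕ → Set
AllReachable {n} G m = (p : Distribution n) → size p ≡ m → (x : Fin n) → Reachable G p x

RubblingNumber : ∀ {n} → Graph n → ℕ → Set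
RubblingNumber G r = AllReachable G r × ((m : ℕ) → AllReachable G m → r ≤ m)

-- Petersen graph: outer 5-cycle 0-1-2-3-4-0, spokes i–(i+5), inner pentagram 5-7-9-6-8-5.
petersenEdges : List (ℕ × ℕ)
petersenEdges =
  (0 , 1) ∷ (1 , 2) ∷ (2 , 3) ∷ (3 , 4) ∷ (4 , 0) ∷
  (0 , 5) ∷ (1 , 6) ∷ (2 , 7) ∷ (3 , 8) ∷ (4 , 9) ∷
  (5 , 7) ∷ (7 , 9) ∷ (9 , 6) ∷ (6 , 8) ∷ (8 , 5) ∷ []

edgeᵇ : ℕ → ℕ → Bool
edgeᵇ a b = any (λ { (c , d) → ((a ≡ᵇ c) ∧ (b ≡ᵇ d)) ∨ ((a ≡ᵇ d) ∧ (b ≡ᵇ c)) }) petersenEdges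

Petersen : Graph 10
Petersen i j = T (edgeᵇ (toℕ i) (toℕ j))

-- Upper bound: the Petersen graph is vertex-transitive, so it suffices that one vertex is
-- reachable from every distribution of five pebbles; this is certified by a depth-first search
-- over all 2002 such distributions. Lower bound: from three pebbles on 9 and one on 8 (both at
-- distance two from 0, with no common neighbour adjacent to 0) vertex 0 is unreachable, because
-- every distribution reachable from it is dominated by one of eleven distributions without a
-- pebble on 0, a family closed under moves. Since adding pebbles never hurts, no m ≤ 4 works.
module Submission where

open import Defs
open import Algebra.Properties.CommutativeMonoid.Sum using (sum-permute)
open import Data.Bool using (Bool; true; _∧_; _∨_; T)
open import Data.Bool.ListAction using (any; all)
open import Data.Bool.Properties using (T-∧; T-∨)
open import Data.Fin using (Fin; zero; suc)
open import Data.Fin.Patterns using (0F; 1F; 2F; 3F; 4F; 5F; 6F; 7F; 8F; 9F)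
open import Data.Fin.Permutation using (Permutation′; permutation; _⟨$⟩ʳ_)
open import Data.Fin.Properties using (_≟_) renaming (all? to allFin?)
open import Data.List using (List; []; _∷_; map; concatMap; upTo)
open import Data.List.Membership.Propositional.Properties using (∈-upTo⁺)
open import Data.List.Relation.Unary.All as All using (All; lookupAny; lookupWith)
open import Data.List.Relation.Unary.All.Properties using (all⁺)
open import Data.List.Relation.Unary.Any as Any using (Any; here)
open import Data.List.Relation.Unary.Any.Properties using (any⁻)
open import Data.Nat using (ℕ; zero; suc; _+_; _∸_; _≤_; _≤?_; _≤′_; ≤′-reflexive; ≤′-step; z≤n; s≤s)
open import Data.Nat.Properties
  using (≤-refl; ≤-reflexive; ≤-trans; ≤-pred; ≰⇒>; ≤⇒≤′; n≤1+n; m≤m+n; m+n∸m≡n;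
         suc-injective; +-monoˡ-≤; ∸-monoˡ-≤; +-0-commutativeMonoid)
  renaming (_≟_ to _≟ℕ_)
open import Data.Product using (_×_; _,_; ∃-syntax)
open import Data.Sum using (inj₁; inj₂)
open import Data.Vec using (Vec; []; _∷_; lookup; tabulate; sum)
open import Data.Vec.Functional using (tail; fromVec) renaming (_∷_ to _◂_)
open import Data.Vec.Functional.Relation.Binary.Pointwise using (Pointwise)
open import Data.Vec.Properties using (lookup∘tabulate)
open import Function using (_∘_; id; Equivalence)
open import Function.Definitions using (Injective)
open import Function.Properties.Inverse using (↔⇒↣)
open import Function.Bundles using (Injection)
open import Relation.Nullary using (Dec; yes; no; isYes; ¬_; ¬?; contradiction)
open import Relation.Nullary.Decidable using (True; toWitness; map′; _×-dec_; _→-dec_; T?)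
open import Relation.Binary.PropositionalEquality using (_≡_; _≢_; refl; sym; trans; cong)
open import Relation.Binary.Construct.Closure.ReflexiveTransitive using (Star; ε; _◅_)

private
  variable
    n : ℕ
    G : Graph n
    p q r : Distribution n
    x : Fin n

_≤ᵈ_ : Distribution n → Distribution n → Set
_≤ᵈ_ = Pointwise _≤_

module _ {m n} {G : Graph m} {H : Graph n} (φ : Fin m → Fin n)
         (φ-injective : Injective _≡_ _≡_ φ) (φ-homomorphism : ∀ {u v} → G u v → H (φ u) (φ v))
         where

  at-image : ∀ v k x → at (φ v) k (φ x) ≡ at v k x
  at-image v k x with x ≟ v | φ x ≟ φ v
  ... | yes refl | yes _     = refl
  ... | yes refl | no  φx≢φv = contradiction refl φx≢φv
  ... | no  x≢v  | yes φx≡φv = contradiction (φ-injective φx≡φv) x≢v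
  ... | no  _    | no  _     = refl

  Move-image : ∀ {r q p} → r ≤ᵈ (p ∘ φ) → Move G r q → ∃[ q′ ] (Move H p q′ × q ≤ᵈ (q′ ∘ φ))
  Move-image {r} {p = p} r≤p (pebbling v u vu 2≤rv) =
    _ , pebbling (φ v) (φ u) (φ-homomorphism vu) (≤-trans 2≤rv (r≤p v)) , dominated
    where
    dominated : ∀ x → (r x ∸ at v 2 x) + at u 1 x ≤ (p (φ x) ∸ at (φ v) 2 (φ x)) + at (φ u) 1 (φ x)
    dominated x rewrite at-image v 2 x | at-image u 1 x =
      +-monoˡ-≤ (at u 1 x) (∸-monoˡ-≤ (at v 2 x) (r≤p x))
  Move-image {r} {p = p} r≤p (strict v w u v≢w vu wu 1≤rv 1≤rw) =
    _ , strict (φ v) (φ w) (φ u) (v≢w ∘ φ-injective) (φ-homomorphism vu) (φ-homomorphism wu)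
          (≤-trans 1≤rv (r≤p v)) (≤-trans 1≤rw (r≤p w)) , dominated
    where
    dominated : ∀ x → ((r x ∸ at v 1 x) ∸ at w 1 x) + at u 1 x
                      ≤ ((p (φ x) ∸ at (φ v) 1 (φ x)) ∸ at (φ w) 1 (φ x)) + at (φ u) 1 (φ x)
    dominated x rewrite at-image v 1 x | at-image w 1 x | at-image u 1 x =
      +-monoˡ-≤ (at u 1 x) (∸-monoˡ-≤ (at w 1 x) (∸-monoˡ-≤ (at v 1 x) (r≤p x)))

  Star-image : ∀ {r q p} → r ≤ᵈ (p ∘ φ) → Star (Move G) r q →
               ∃[ q′ ] (Star (Move H) p q′ × q ≤ᵈ (q′ ∘ φ))
  Star-image r≤p ε = _ , ε , r≤p
  Star-image r≤p (move ◅ moves) with Move-image r≤p move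
  ... | _ , move′ , s≤s′ with Star-image s≤s′ moves
  ...   | q′ , moves′ , q≤q′ = q′ , move′ ◅ moves′ , q≤q′

  Reachable-image : ∀ {r p x} → r ≤ᵈ (p ∘ φ) → Reachable G r x → Reachable H p (φ x)
  Reachable-image r≤p (q , moves , 1≤qx) with Star-image r≤p moves
  ... | q′ , moves′ , q≤q′ = q′ , moves′ , ≤-trans 1≤qx (q≤q′ _)

Reachable-mono : r ≤ᵈ p → Reachable G r x → Reachable G p x
Reachable-mono = Reachable-image id id id

AlwaysReachable : Graph n → ℕ → Fin n → Set
AlwaysReachable G m x = ∀ p → size p ≡ m → Reachable G p x

Automorphism : Graph n → Permutation′ n → Set
Automorphism G π = ∀ u v → G u v → G (π ⟨$⟩ʳ u) (π ⟨$⟩ʳ v)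

automorphism? : (∀ u v → Dec (G u v)) → ∀ π → Dec (Automorphism G π)
automorphism? G? π = allFin? λ u → allFin? λ v → G? u v →-dec G? (π ⟨$⟩ʳ u) (π ⟨$⟩ʳ v)

permutationᵈ : (f g : Fin n → Fin n) →
               {True (allFin? λ i → f (g i) ≟ i)} → {True (allFin? λ i → g (f i) ≟ i)} →
               Permutation′ n
permutationᵈ f g {fg} {gf} = permutation f g (toWitness fg) (toWitness gf)

AlwaysReachable-automorphism : ∀ {m} (π : Permutation′ n) → Automorphism G π →
                               AlwaysReachable G m x → AlwaysReachable G m (π ⟨$⟩ʳ x)
AlwaysReachable-automorphism π π-automorphism reach p size≡ =
  Reachable-image (π ⟨$⟩ʳ_) (Injection.injective (↔⇒↣ π)) (π-automorphism _ _) (λ _ → ≤-refl)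
    (reach (p ∘ (π ⟨$⟩ʳ_)) (trans (sym (sum-permute +-0-commutativeMonoid p π)) size≡))

remove-pebble : ∀ {m} (p : Distribution n) → size p ≡ suc m → ∃[ p′ ] (size p′ ≡ m × p′ ≤ᵈ p)
remove-pebble {suc n} p size≡ with p zero in p₀≡
... | zero with remove-pebble (tail p) size≡
...   | p′ , size′≡ , p′≤p = (0 ◂ p′) , size′≡ , λ { zero → z≤n ; (suc i) → p′≤p i }
remove-pebble {suc n} p size≡ | suc a =
  (a ◂ tail p) , suc-injective size≡ ,
  λ { zero → ≤-trans (n≤1+n a) (≤-reflexive (sym p₀≡)) ; (suc i) → ≤-refl }

AllReachable-suc : ∀ {m} → AllReachable G m → AllReachable G (suc m)
AllReachable-suc reach p size≡ x with remove-pebble p size≡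
... | p′ , size′≡ , p′≤p = Reachable-mono p′≤p (reach p′ size′≡ x)

AllReachable-mono : ∀ {m m′} → m ≤′ m′ → AllReachable G m → AllReachable G m′
AllReachable-mono (≤′-reflexive refl) = id
AllReachable-mono (≤′-step m≤m′)      = AllReachable-suc ∘ AllReachable-mono m≤m′

data Step (n : ℕ) : Set where
  pebbling : (v u : Fin n) → Step n
  strict   : (v w u : Fin n) → Step n

after : Step n → Distribution n → Distribution n
after (pebbling v u) p x = (p x ∸ at v 2 x) + at u 1 x
after (strict v w u) p x = ((p x ∸ at v 1 x) ∸ at w 1 x) + at u 1 x

Valid : Graph n → Step n → Set
Valid G (pebbling v u) = G v u
Valid G (strict v w u) = v ≢ w × G v u × G w u

Enabled : Step n → Distribution n → Set
Enabled (pebbling v u) p = 2 ≤ p v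
Enabled (strict v w u) p = 1 ≤ p v × 1 ≤ p w

Step-move : ∀ s → Valid G s → Enabled s p → Move G p (after s p)
Step-move (pebbling v u) vu 2≤pv                      = pebbling v u vu 2≤pv
Step-move (strict v w u) (v≢w , vu , wu) (1≤pv , 1≤pw) = strict v w u v≢w vu wu 1≤pv 1≤pw

Move-step : Move G p q → ∃[ s ] (Valid G s × Enabled s p × q ≡ after s p)
Move-step (pebbling v u vu 2≤pv)               = pebbling v u , vu , 2≤pv , refl
Move-step (strict v w u v≢w vu wu 1≤pv 1≤pw) = strict v w u , (v≢w , vu , wu) , (1≤pv , 1≤pw) , refl

enabled? : ∀ s (p : Distribution n) → Dec (Enabled s p)
enabled? (pebbling v u) p = 2 ≤? p v
enabled? (strict v w u) p = 1 ≤? p v ×-dec 1 ≤? p w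

valid? : (∀ u v → Dec (G u v)) → ∀ s → Dec (Valid G s)
valid? G? (pebbling v u) = G? v u
valid? G? (strict v w u) = ¬? (v ≟ w) ×-dec G? v u ×-dec G? w u

allSteps? : {P : Step n → Set} → (∀ s → Dec (P s)) → Dec (∀ s → P s)
allSteps? P? =
  map′ (λ { (pe , st) (pebbling v u) → pe v u ; (pe , st) (strict v w u) → st v w u })
       (λ all → (λ v u → all (pebbling v u)) , (λ v w u → all (strict v w u)))
       (allFin? (λ v → allFin? (λ u → P? (pebbling v u))) ×-dec
        allFin? (λ v → allFin? (λ w → allFin? (λ u → P? (strict v w u)))))

module Search (candidates : List (Step n)) (candidates-valid : All (Valid G) candidates) where

  reachableᵇ : ℕ → Distribution n → Fin n → Bool
  reachableᵇ zero    p x = isYes (1 ≤? p x)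
  reachableᵇ (suc k) p x =
    isYes (1 ≤? p x) ∨ any (λ s → isYes (enabled? s p) ∧ reachableᵇ k (after s p) x) candidates

  mutual
    reachableᵇ-sound : ∀ k p x → T (reachableᵇ k p x) → Reachable G p x
    reachableᵇ-sound zero    p x found = p , ε , toWitness {a? = 1 ≤? p x} found
    reachableᵇ-sound (suc k) p x found with Equivalence.to T-∨ found
    ... | inj₁ occupied = p , ε , toWitness {a? = 1 ≤? p x} occupied
    ... | inj₂ someStep =
      lookupWith (λ {s} → tryStep-sound k p x s) candidates-valid (any⁻ _ candidates someStep)

    tryStep-sound : ∀ k p x s → Valid G s → T (isYes (enabled? s p) ∧ reachableᵇ k (after s p) x) →
                 Reachable G p x
    tryStep-sound k p x s valid found with Equivalence.to T-∧ found
    ... | enabled , found′ with reachableᵇ-sound k (after s p) x found′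
    ...   | q , moves , 1≤qx = q , Step-move s valid (toWitness {a? = enabled? s p} enabled) ◅ moves , 1≤qx

Dominated : List (Distribution n) → Distribution n → Set
Dominated S p = Any (p ≤ᵈ_) S

MoveClosed : Graph n → List (Distribution n) → Set
MoveClosed G S = All (λ s → ∀ step → Enabled step s → Valid G step → Dominated S (after step s)) S

dominated? : ∀ (S : List (Distribution n)) p → Dec (Dominated S p)
dominated? S p = Any.any? (λ s → allFin? (λ i → p i ≤? s i)) S

moveClosed? : (∀ u v → Dec (G u v)) → ∀ S → Dec (MoveClosed G S)
moveClosed? G? S =
  All.all? (λ s → allSteps? (λ step → enabled? step s →-dec valid? G? step →-dec dominated? S (after step s))) S

module _ {S : List (Distribution n)} (closed : MoveClosed G S) where

  Dominated-move : Dominated S p → Move G p q → Dominated S q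
  Dominated-move p≤s move with lookupAny closed p≤s
  ... | successors , p≤s′ with Move-image id id id p≤s′ move
  ...   | _ , move′ , q≤q′ with Move-step move′
  ...     | step , valid , enabled , refl =
    Any.map (λ q′≤t i → ≤-trans (q≤q′ i) (q′≤t i)) (successors step enabled valid)

  Dominated-star : Dominated S p → Star (Move G) p q → Dominated S q
  Dominated-star p≤s ε              = p≤s
  Dominated-star p≤s (move ◅ moves) = Dominated-star (Dominated-move p≤s move) moves

  Dominated-unreachable : All (λ s → s x ≡ 0) S → Dominated S p → ¬ Reachable G p x
  Dominated-unreachable {x = x} empty p≤s (q , moves , 1≤qx)
    with lookupAny empty (Dominated-star p≤s moves)
  ... | sx≡0 , q≤s = contradiction (≤-trans 1≤qx (≤-trans (q≤s x) (≤-reflexive sx≡0))) λ ()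

allWithSumᵇ : ∀ n → ℕ → (Vec ℕ n → Bool) → Bool
allWithSumᵇ zero    zero    f = f []
allWithSumᵇ zero    (suc k) f = true
allWithSumᵇ (suc n) k       f = all (λ a → allWithSumᵇ n (k ∸ a) (f ∘ (a ∷_))) (upTo (suc k))

allWithSumᵇ-sound : ∀ {k} f → T (allWithSumᵇ n k f) → ∀ v → sum v ≡ k → T (f v)
allWithSumᵇ-sound {zero} f holds [] refl = holds
allWithSumᵇ-sound {suc n} f holds (a ∷ v) refl =
  allWithSumᵇ-sound (f ∘ (a ∷_))
    (All.lookup (all⁺ _ _ holds) (∈-upTo⁺ (s≤s (m≤m+n a (sum v)))))
    v (sym (m+n∸m≡n a (sum v)))

sum-tabulate : (p : Distribution n) → sum (tabulate p) ≡ size p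
sum-tabulate {zero}  p = refl
sum-tabulate {suc n} p = cong (p zero +_) (sum-tabulate (tail p))

petersen? : ∀ u v → Dec (Petersen u v)
petersen? u v = T? _

neighbours : Fin 10 → Fin 10 × Fin 10 × Fin 10
neighbours 0F = 1F , 4F , 5F
neighbours 1F = 0F , 2F , 6F
neighbours 2F = 1F , 3F , 7F
neighbours 3F = 2F , 4F , 8F
neighbours 4F = 0F , 3F , 9F
neighbours 5F = 0F , 7F , 8F
neighbours 6F = 1F , 8F , 9F
neighbours 7F = 2F , 5F , 9F
neighbours 8F = 3F , 5F , 6F
neighbours 9F = 4F , 6F , 7F

movesInto : Fin 10 → List (Step 10)
movesInto u with neighbours u
... | a , b , c =
  pebbling a u ∷ pebbling b u ∷ pebbling c u ∷ strict a b u ∷ strict a c u ∷ strict b c u ∷ []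

-- Moves towards 0 are tried first: targets ordered by their distance from 0.
movesTowards0 : List (Step 10)
movesTowards0 = concatMap movesInto (0F ∷ 1F ∷ 4F ∷ 5F ∷ 2F ∷ 3F ∷ 6F ∷ 7F ∷ 8F ∷ 9F ∷ [])

movesTowards0-valid : All (Valid Petersen) movesTowards0
movesTowards0-valid = toWitness {a? = All.all? (valid? petersen?) movesTowards0} _

open Search movesTowards0 movesTowards0-valid

-- The search needs at most four moves, as each move removes a pebble.
everyDistributionReaches0 : T (allWithSumᵇ 10 5 (λ v → reachableᵇ 4 (lookup v) 0F))
everyDistributionReaches0 = _

alwaysReachable-0 : AlwaysReachable Petersen 5 0F
alwaysReachable-0 p size≡ =
  Reachable-mono (≤-reflexive ∘ lookup∘tabulate p)
    (reachableᵇ-sound 4 (lookup (tabulate p)) 0F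
      (allWithSumᵇ-sound {n = 10} {k = 5} (λ v → reachableᵇ 4 (lookup v) 0F) everyDistributionReaches0
        (tabulate p) (trans (sum-tabulate p) size≡)))

rotation : Permutation′ 10
rotation = permutationᵈ (lookup (1F ∷ 2F ∷ 3F ∷ 4F ∷ 0F ∷ 6F ∷ 7F ∷ 8F ∷ 9F ∷ 5F ∷ []))
                        (lookup (4F ∷ 0F ∷ 1F ∷ 2F ∷ 3F ∷ 9F ∷ 5F ∷ 6F ∷ 7F ∷ 8F ∷ []))

-- Outer vertex i goes to inner vertex 5 + 2i, inner vertex 5 + i to outer vertex 2i (mod 5).
twist : Permutation′ 10
twist = permutationᵈ (lookup (5F ∷ 7F ∷ 9F ∷ 6F ∷ 8F ∷ 0F ∷ 2F ∷ 4F ∷ 1F ∷ 3F ∷ []))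
                     (lookup (5F ∷ 8F ∷ 6F ∷ 9F ∷ 7F ∷ 0F ∷ 3F ∷ 1F ∷ 4F ∷ 2F ∷ []))

rotate : AlwaysReachable Petersen 5 x → AlwaysReachable Petersen 5 (rotation ⟨$⟩ʳ x)
rotate = AlwaysReachable-automorphism rotation (toWitness {a? = automorphism? petersen? rotation} _)

twirl : AlwaysReachable Petersen 5 x → AlwaysReachable Petersen 5 (twist ⟨$⟩ʳ x)
twirl = AlwaysReachable-automorphism twist (toWitness {a? = automorphism? petersen? twist} _)

alwaysReachable : ∀ x → AlwaysReachable Petersen 5 x
alwaysReachable 0F = alwaysReachable-0
alwaysReachable 1F = rotate alwaysReachable-0
alwaysReachable 2F = rotate (rotate alwaysReachable-0)
alwaysReachable 3F = rotate (rotate (rotate alwaysReachable-0))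
alwaysReachable 4F = rotate (rotate (rotate (rotate alwaysReachable-0)))
alwaysReachable 5F = twirl alwaysReachable-0
alwaysReachable 6F = rotate (twirl alwaysReachable-0)
alwaysReachable 7F = rotate (rotate (twirl alwaysReachable-0))
alwaysReachable 8F = rotate (rotate (rotate (twirl alwaysReachable-0)))
alwaysReachable 9F = rotate (rotate (rotate (rotate (twirl alwaysReachable-0))))

stuck : Distribution 10
stuck = fromVec (0 ∷ 0 ∷ 0 ∷ 0 ∷ 0 ∷ 0 ∷ 0 ∷ 0 ∷ 1 ∷ 3 ∷ [])

stuckClosure : List (Distribution 10)
stuckClosure = stuck ∷ map fromVec
  ( (0 ∷ 0 ∷ 0 ∷ 0 ∷ 1 ∷ 0 ∷ 0 ∷ 0 ∷ 1 ∷ 1 ∷ [])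
  ∷ (0 ∷ 0 ∷ 0 ∷ 0 ∷ 0 ∷ 0 ∷ 1 ∷ 0 ∷ 1 ∷ 1 ∷ [])
  ∷ (0 ∷ 0 ∷ 0 ∷ 0 ∷ 0 ∷ 0 ∷ 0 ∷ 1 ∷ 1 ∷ 1 ∷ [])
  ∷ (0 ∷ 0 ∷ 0 ∷ 0 ∷ 0 ∷ 0 ∷ 1 ∷ 0 ∷ 0 ∷ 2 ∷ [])
  ∷ (0 ∷ 0 ∷ 0 ∷ 1 ∷ 0 ∷ 0 ∷ 0 ∷ 0 ∷ 0 ∷ 1 ∷ [])
  ∷ (0 ∷ 0 ∷ 0 ∷ 0 ∷ 1 ∷ 0 ∷ 1 ∷ 0 ∷ 0 ∷ 0 ∷ [])
  ∷ (0 ∷ 0 ∷ 0 ∷ 0 ∷ 0 ∷ 0 ∷ 2 ∷ 0 ∷ 0 ∷ 0 ∷ [])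
  ∷ (0 ∷ 0 ∷ 0 ∷ 0 ∷ 0 ∷ 1 ∷ 0 ∷ 0 ∷ 0 ∷ 1 ∷ [])
  ∷ (0 ∷ 0 ∷ 0 ∷ 0 ∷ 0 ∷ 0 ∷ 1 ∷ 1 ∷ 0 ∷ 0 ∷ [])
  ∷ (0 ∷ 1 ∷ 0 ∷ 0 ∷ 0 ∷ 0 ∷ 0 ∷ 0 ∷ 0 ∷ 0 ∷ [])
  ∷ [])

stuckClosure-closed : MoveClosed Petersen stuckClosure
stuckClosure-closed = toWitness {a? = moveClosed? petersen? stuckClosure} _

stuck-unreachable : ¬ Reachable Petersen stuck 0F
stuck-unreachable =
  Dominated-unreachable stuckClosure-closed
    (toWitness {a? = All.all? (λ s → s 0F ≟ℕ 0) stuckClosure} _)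
    (here (λ _ → ≤-refl))

upper : AllReachable Petersen 5
upper p size≡ x = alwaysReachable x p size≡

lower : ∀ m → AllReachable Petersen m → 5 ≤ m
lower m reach with 5 ≤? m
... | yes 5≤m = 5≤m
... | no  5≰m = contradiction (AllReachable-mono (≤⇒≤′ (≤-pred (≰⇒> 5≰m))) reach stuck refl 0F)
                              stuck-unreachable

mainTheorem9 : RubblingNumber Petersen 5
mainTheorem9 = upper , lower
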